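{- Let $\overline{(\cdot)}$ be the continuation-and-garbage-passing (CGPS) translation from the calculus $\lambda\mathbf{J}^{\mathbf{mse}}$ into the untyped $\lambda$-calculus described in the context. For all terms $t,u$ of $\lambda\mathbf{J}^{\mathbf{mse}}$, if $t\rightarrow u$ in $\lambda\mathbf{J}^{\mathbf{mse}}$, then $\overline{t}\rightarrow^+_{\beta}\overline{u}$ (one or more $\beta$-steps) in the $\lambda$-calculus.
   Context: The calculus $\lambda\mathbf{J}^{\mathbf{mse}}$ has three syntactic classes: terms $t,u,v::= x\mid \lambda x.t\mid \{c\}$; co-terms $l::= []\mid u::l\mid (x)c$; commands $c::= t\,l$ (a term followed by a co-term). $\lambda x$ binds $x$ in $t$ and $(x)$ binds $x$ in $c$; expressions are taken up to renaming of bound variables and $[t/x]T$ is capture-avoiding substitution. Co-terms of the form $[]$ or $u::l$ are called evaluation contexts, ranged over by $E$. A value $V$ is a variable or a $\lambda$-abstraction. Append of co-terms is defined by $[]@l'=l'$, $(u::l)@l'=u::(l@l')$, $((x)\,t\,l)@l'=(x)\,t\,(l@l')$. The one-step reduction $\rightarrow$ is the closure under all term/co-term/command constructors of the rules: $(\beta)\ (\lambda x.t)(u::l)\rightarrow u\,((x)\,t\,l)$; $(\pi)\ \{t\,l\}\,E\rightarrow t\,(l@E)$; $(\sigma)\ t\,(x)c\rightarrow [t/x]c$; $(\mu)\ (x)\,x\,l\rightarrow l$ if $x$ is not free in $l$; $(\epsilon)\ \{t\,[]\}\rightarrow t$. Translation. Fix a closed $\lambda$-term $\mathsf{s}$ such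 that $\mathsf{s}\,G\rightarrow^+_\beta G$ for every $G$ (e.g. $\mathsf{s}=\lambda z.z$), and write $G^+:=\mathsf{s}\,G$. Write $[t;u]:=(\lambda y.t)u$ with $y$ not free in $t$. For every expression $T$ of $\lambda\mathbf{J}^{\mathbf{mse}}$ and $\lambda$-terms $G,K$ define the $\lambda$-term $(T:G,K)$ by (with $w,m$ fresh variables): $(x:G,K)=x\,G^+\,K$; $(\lambda x.t:G,K)=[K(\lambda w x.w\,\overline{t});G]$; $(\{c\}:G,K)=(c:G^+,K)$; $([]:G,K)=\lambda w.w\,G\,K$; $(u::l:G,K)=\lambda w.w\,G\,(\lambda m.m\,(l:G,K)\,\overline{u})$; $((x)c:G,K)=\lambda x.(c:G,K)$; $(t\,[]:G,K)=(t:G,K)$; $(t\,(u::l):G,K)=(t:G,\lambda m.m\,(l:G,K)\,\overline{u})$; $(t\,(x)c:G,K)=((x)c:G,K)\,\overline{t}$; and $\overline{t}=\lambda g k.(t:g,k)$ with $g,k$ fresh. -}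

module Defs where

-- Well-scoped de Bruijn syntax: an expression in scope n has free
-- variables among Fin n (index 0 = innermost binder).

open import Data.Nat using (ℕ; zero; suc)
open import Data.Fin using (Fin; zero; suc)

fs : ∀ {n} → Fin n → Fin (suc n)
fs i = suc i
open import Function using (_∘_; id)
open import Relation.Binary.Construct.Closure.Transitive using (TransClosure)

ext : ∀ {m n} → (Fin m → Fin n) → Fin (suc m) → Fin (suc n)
ext ρ zero    = zero
ext ρ (suc i) = suc (ρ i)

data Λ (n : ℕ) : Set where
  var : Fin n → Λ n
  lam : Λ (suc n) → Λ n
  app : Λ n → Λ n → Λ n

renΛ : ∀ {m n} → (Fin m → Fin n) → Λ m → Λ n
renΛ ρ (var x)   = var (ρ x)
renΛ ρ (lam t)   = lam (renΛ (ext ρ) t)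
renΛ ρ (app t u) = app (renΛ ρ t) (renΛ ρ u)

wkΛ : ∀ {n} → Λ n → Λ (suc n)
wkΛ = renΛ suc

extsΛ : ∀ {m n} → (Fin m → Λ n) → Fin (suc m) → Λ (suc n)
extsΛ σ zero    = var zero
extsΛ σ (suc i) = wkΛ (σ i)

subΛ : ∀ {m n} → (Fin m → Λ n) → Λ m → Λ n
subΛ σ (var x)   = σ x
subΛ σ (lam t)   = lam (subΛ (extsΛ σ) t)
subΛ σ (app t u) = app (subΛ σ t) (subΛ σ u)

sub1Λ : ∀ {n} → Λ (suc n) → Λ n → Λ n
sub1Λ {n} t u = subΛ σ t
  where
  σ : Fin (suc n) → Λ n
  σ zero    = u
  σ (suc i) = var i

data _⟶β_ {n : ℕ} : Λ n → Λ n → Set where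
  β    : ∀ {t : Λ (suc n)} {u : Λ n} → app (lam t) u ⟶β sub1Λ t u
  ξlam : ∀ {t t' : Λ (suc n)} → t ⟶β t' → lam t ⟶β lam t'
  ξappₗ : ∀ {t t' u : Λ n} → t ⟶β t' → app t u ⟶β app t' u
  ξappᵣ : ∀ {t u u' : Λ n} → u ⟶β u' → app t u ⟶β app t u'

_⟶β⁺_ : ∀ {n} → Λ n → Λ n → Set
_⟶β⁺_ = TransClosure _⟶β_

closedΛ : ∀ {n} → Λ 0 → Λ n
closedΛ = renΛ (λ ())

mutual
  -- terms  t ::= x | λx.t | {c}
  data Term (n : ℕ) : Set where
    var   : Fin n → Term n
    lam   : Term (suc n) → Term n
    brace : Cmd n → Term n

  -- co-terms  l ::= [] | u :: l | (x)c
  data CoTerm (n : ℕ) : Set where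
    nil  : CoTerm n
    cons : Term n → CoTerm n → CoTerm n
    mu   : Cmd (suc n) → CoTerm n

  data Cmd (n : ℕ) : Set where
    cmd : Term n → CoTerm n → Cmd n

mutual
  renT : ∀ {m n} → (Fin m → Fin n) → Term m → Term n
  renT ρ (var x)   = var (ρ x)
  renT ρ (lam t)   = lam (renT (ext ρ) t)
  renT ρ (brace c) = brace (renC ρ c)

  renL : ∀ {m n} → (Fin m → Fin n) → CoTerm m → CoTerm n
  renL ρ nil        = nil
  renL ρ (cons u l) = cons (renT ρ u) (renL ρ l)
  renL ρ (mu c)     = mu (renC (ext ρ) c)

  renC : ∀ {m n} → (Fin m → Fin n) → Cmd m → Cmd n
  renC ρ (cmd t l) = cmd (renT ρ t) (renL ρ l)

extsT : ∀ {m n} → (Fin m → Term n) → Fin (suc m) → Term (suc n)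
extsT σ zero    = var zero
extsT σ (suc i) = renT suc (σ i)

mutual
  subT : ∀ {m n} → (Fin m → Term n) → Term m → Term n
  subT σ (var x)   = σ x
  subT σ (lam t)   = lam (subT (extsT σ) t)
  subT σ (brace c) = brace (subC σ c)

  subL : ∀ {m n} → (Fin m → Term n) → CoTerm m → CoTerm n
  subL σ nil        = nil
  subL σ (cons u l) = cons (subT σ u) (subL σ l)
  subL σ (mu c)     = mu (subC (extsT σ) c)

  subC : ∀ {m n} → (Fin m → Term n) → Cmd m → Cmd n
  subC σ (cmd t l) = cmd (subT σ t) (subL σ l)

sub1C : ∀ {n} → Cmd (suc n) → Term n → Cmd n
sub1C {n} c t = subC σ c
  where
  σ : Fin (suc n) → Term n
  σ zero    = t
  σ (suc i) = var i

_++ₗ_ : ∀ {n} → CoTerm n → CoTerm n → CoTerm n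
nil        ++ₗ l' = l'
cons u l   ++ₗ l' = cons u (l ++ₗ l')
mu (cmd t l) ++ₗ l' = mu (cmd t (l ++ₗ renL suc l'))

data IsEvalCtx {n : ℕ} : CoTerm n → Set where
  nilE  : IsEvalCtx nil
  consE : ∀ {u l} → IsEvalCtx (cons u l)

mutual
  data _⟶T_ {n : ℕ} : Term n → Term n → Set where
    ε      : ∀ {t : Term n} → brace (cmd t nil) ⟶T t
    ξlam   : ∀ {t t' : Term (suc n)} → t ⟶T t' → lam t ⟶T lam t'
    ξbrace : ∀ {c c' : Cmd n} → c ⟶C c' → brace c ⟶T brace c'

  data _⟶L_ {n : ℕ} : CoTerm n → CoTerm n → Set where
    μ      : ∀ {l : CoTerm n} → mu (cmd (var zero) (renL suc l)) ⟶L l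
    ξconsₗ : ∀ {u u' : Term n} {l : CoTerm n} → u ⟶T u' → cons u l ⟶L cons u' l
    ξconsᵣ : ∀ {u : Term n} {l l' : CoTerm n} → l ⟶L l' → cons u l ⟶L cons u l'
    ξmu    : ∀ {c c' : Cmd (suc n)} → c ⟶C c' → mu c ⟶L mu c'

  data _⟶C_ {n : ℕ} : Cmd n → Cmd n → Set where
    β      : ∀ {t : Term (suc n)} {u : Term n} {l : CoTerm n} →
             cmd (lam t) (cons u l) ⟶C cmd u (mu (cmd t (renL suc l)))
    π      : ∀ {t : Term n} {l E : CoTerm n} → IsEvalCtx E →
             cmd (brace (cmd t l)) E ⟶C cmd t (l ++ₗ E)
    σ      : ∀ {t : Term n} {c : Cmd (suc n)} → cmd t (mu c) ⟶C sub1C c t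
    ξcmdₗ  : ∀ {t t' : Term n} {l : CoTerm n} → t ⟶T t' → cmd t l ⟶C cmd t' l
    ξcmdᵣ  : ∀ {t : Term n} {l l' : CoTerm n} → l ⟶L l' → cmd t l ⟶C cmd t l'

-- The CGPS translation, parameterised by the closed λ-term s.
-- (T : G , K) for T in scope m, with a renaming ρ sending the free
-- variables of T to variables of the target scope n, and G K : Λ n.

module CGPS (s : Λ 0) where

  _⁺g : ∀ {n} → Λ n → Λ n
  G ⁺g = app (closedΛ s) G

  mutual
    trT : ∀ {m n} → Term m → (Fin m → Fin n) → Λ n → Λ n → Λ n
    trT (var x)   ρ G K = app (app (var (ρ x)) (G ⁺g)) K
    -- (λx.t : G,K) = [K (λw x. w t̄) ; G] = (λy. K (λw x. w t̄)) G
    trT (lam t)   ρ G K =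
      app (lam (wkΛ (app K (lam (lam (app (var (suc zero)) (barT t (ext (fs ∘ ρ))))))))) G
    trT (brace c) ρ G K = trC c ρ (G ⁺g) K

    pairK : ∀ {m n} → CoTerm m → Term m → (Fin m → Fin n) → Λ n → Λ n → Λ n
    pairK l u ρ G K = lam (app (app (var zero) (wkΛ (trL l ρ G K))) (wkΛ (barT u ρ)))

    trL : ∀ {m n} → CoTerm m → (Fin m → Fin n) → Λ n → Λ n → Λ n
    trL nil        ρ G K = lam (app (app (var zero) (wkΛ G)) (wkΛ K))
    trL (cons u l) ρ G K = lam (app (app (var zero) (wkΛ G)) (wkΛ (pairK l u ρ G K)))
    trL (mu c)     ρ G K = lam (trC c (ext ρ) (wkΛ G) (wkΛ K))

    trC : ∀ {m n} → Cmd m → (Fin m → Fin n) → Λ n → Λ n → Λ n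
    trC (cmd t nil)        ρ G K = trT t ρ G K
    trC (cmd t (cons u l)) ρ G K = trT t ρ G (pairK l u ρ G K)
    trC (cmd t (mu c))     ρ G K = app (trL (mu c) ρ G K) (barT t ρ)

    barT : ∀ {m n} → Term m → (Fin m → Fin n) → Λ n
    barT t ρ = lam (lam (trT t (fs ∘ fs ∘ ρ) (var (suc zero)) (var zero)))

  ⟦_⟧ : ∀ {n} → Term n → Λ n
  ⟦ t ⟧ = barT t id

module Submission where

-- Each reduction step is simulated by induction on its derivation, for the translation
-- (T : G,K) under an arbitrary renaming ρ of free variables, garbage G and continuation K.
-- β costs three administrative β-steps, σ one β-step followed by a substitution lemma.
-- π, ε and μ are simulated through the garbage: each of them turns some G⁺ = s G into G,
-- and it is s G →⁺ G that makes the simulation strict.  Append is translated exactly: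
-- passing the continuation λm. m (l' : G,K) ū to (l : G,_) yields (l @ (u :: l') : G,K).

open import Defs
open import Data.Nat using (ℕ; suc)
open import Data.Fin using (Fin; zero; suc)
open import Function using (_∘_; id)
open import Relation.Binary.PropositionalEquality
  using (_≡_; _≗_; refl; sym; trans; cong; cong₂; module ≡-Reasoning)
open import Relation.Binary.Construct.Closure.Transitive using ([_]; _∷_; _++_)
open import Relation.Binary.Construct.Closure.ReflexiveTransitive as Star using (Star; ε; _◅_; _◅◅_)

private
  variable
    k m m' n n' : ℕ

ext-∘ : {f : Fin m → Fin n} {g : Fin k → Fin m} {h : Fin k → Fin n} →
        f ∘ g ≗ h → ext f ∘ ext g ≗ ext h
ext-∘ fg≗h zero    = refl
ext-∘ fg≗h (suc x) = cong suc (fg≗h x)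

renΛ-∘ : {f : Fin m → Fin n} {g : Fin k → Fin m} {h : Fin k → Fin n} →
         f ∘ g ≗ h → renΛ f ∘ renΛ g ≗ renΛ h
renΛ-∘ fg≗h (var x)   = cong var (fg≗h x)
renΛ-∘ fg≗h (lam M)   = cong lam (renΛ-∘ (ext-∘ fg≗h) M)
renΛ-∘ fg≗h (app M N) = cong₂ app (renΛ-∘ fg≗h M) (renΛ-∘ fg≗h N)

renΛ-ext-wkΛ : (f : Fin m → Fin n) → renΛ (ext f) ∘ wkΛ ≗ wkΛ ∘ renΛ f
renΛ-ext-wkΛ f M = trans (renΛ-∘ (λ _ → refl) M) (sym (renΛ-∘ (λ _ → refl) M))

renΛ-subΛ : {f : Fin m → Fin n} {θ : Fin k → Λ m} {θ' : Fin k → Λ n} →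
            renΛ f ∘ θ ≗ θ' → renΛ f ∘ subΛ θ ≗ subΛ θ'
renΛ-subΛ                  fθ≗θ' (var x)   = fθ≗θ' x
renΛ-subΛ {f = f} {θ} {θ'} fθ≗θ' (lam M)   = cong lam (renΛ-subΛ exts M)
  where
  exts : renΛ (ext f) ∘ extsΛ θ ≗ extsΛ θ'
  exts zero    = refl
  exts (suc i) = trans (renΛ-ext-wkΛ f (θ i)) (cong wkΛ (fθ≗θ' i))
renΛ-subΛ                  fθ≗θ' (app M N) =
  cong₂ app (renΛ-subΛ fθ≗θ' M) (renΛ-subΛ fθ≗θ' N)

subΛ-renΛ : {f : Fin k → Fin m} {θ : Fin m → Λ n} {θ' : Fin k → Λ n} →
            θ ∘ f ≗ θ' → subΛ θ ∘ renΛ f ≗ subΛ θ'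
subΛ-renΛ                  θf≗θ' (var x)   = θf≗θ' x
subΛ-renΛ {f = f} {θ} {θ'} θf≗θ' (lam M)   = cong lam (subΛ-renΛ exts M)
  where
  exts : extsΛ θ ∘ ext f ≗ extsΛ θ'
  exts zero    = refl
  exts (suc i) = cong wkΛ (θf≗θ' i)
subΛ-renΛ                  θf≗θ' (app M N) =
  cong₂ app (subΛ-renΛ θf≗θ' M) (subΛ-renΛ θf≗θ' N)

extsΛ-cong : {θ θ' : Fin m → Λ n} → θ ≗ θ' → extsΛ θ ≗ extsΛ θ'
extsΛ-cong θ≗θ' zero    = refl
extsΛ-cong θ≗θ' (suc i) = cong wkΛ (θ≗θ' i)

subΛ-cong : {θ θ' : Fin m → Λ n} → θ ≗ θ' → subΛ θ ≗ subΛ θ'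
subΛ-cong θ≗θ' (var x)   = θ≗θ' x
subΛ-cong θ≗θ' (lam M)   = cong lam (subΛ-cong (extsΛ-cong θ≗θ') M)
subΛ-cong θ≗θ' (app M N) = cong₂ app (subΛ-cong θ≗θ' M) (subΛ-cong θ≗θ' N)

extsΛ-var : {θ : Fin n → Λ n} → θ ≗ var → extsΛ θ ≗ var
extsΛ-var θ≗var zero    = refl
extsΛ-var θ≗var (suc i) = cong wkΛ (θ≗var i)

subΛ-id : {θ : Fin n → Λ n} → θ ≗ var → subΛ θ ≗ id
subΛ-id θ≗var (var x)   = θ≗var x
subΛ-id θ≗var (lam M)   = cong lam (subΛ-id (extsΛ-var θ≗var) M)
subΛ-id θ≗var (app M N) = cong₂ app (subΛ-id θ≗var M) (subΛ-id θ≗var N)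

renΛ-as-subΛ : (f : Fin m → Fin n) → renΛ f ≗ subΛ (var ∘ f)
renΛ-as-subΛ f M = begin
  renΛ f M                 ≡⟨ cong (renΛ f) (sym (subΛ-id (λ _ → refl) M)) ⟩
  renΛ f (subΛ var M)      ≡⟨ renΛ-subΛ (λ _ → refl) M ⟩
  subΛ (var ∘ f) M         ∎
  where open ≡-Reasoning

subΛ-extsΛ-wkΛ : (θ : Fin m → Λ n) → subΛ (extsΛ θ) ∘ wkΛ ≗ wkΛ ∘ subΛ θ
subΛ-extsΛ-wkΛ θ M = trans (subΛ-renΛ (λ _ → refl) M) (sym (renΛ-subΛ (λ _ → refl) M))

subΛ-closedΛ : (θ : Fin m → Λ n) (M : Λ 0) → subΛ θ (closedΛ M) ≡ closedΛ M
subΛ-closedΛ θ M = trans (subΛ-renΛ (λ ()) M) (sym (renΛ-as-subΛ (λ ()) M))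

single : Λ n → Fin (suc n) → Λ n
single u zero    = u
single u (suc i) = var i

sub1Λ-as-subΛ : (t : Λ (suc n)) (u : Λ n) → sub1Λ t u ≡ subΛ (single u) t
sub1Λ-as-subΛ t u = subΛ-cong (λ { zero → refl ; (suc i) → refl }) t

subΛ-single-wkΛ : (u : Λ n) → subΛ (single u) ∘ wkΛ ≗ id
subΛ-single-wkΛ u M = trans (subΛ-renΛ (λ _ → refl) M) (subΛ-id (λ _ → refl) M)

sub1Λ-wkΛ : (M u : Λ n) → sub1Λ (wkΛ M) u ≡ M
sub1Λ-wkΛ M u = trans (sub1Λ-as-subΛ (wkΛ M) u) (subΛ-single-wkΛ u M)

renΛ-sub1Λ : (f : Fin m → Fin n) (t : Λ (suc m)) (u : Λ m) →
             renΛ f (sub1Λ t u) ≡ sub1Λ (renΛ (ext f) t) (renΛ f u)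
renΛ-sub1Λ {m = m} {n = n} f t u = begin
  renΛ f (sub1Λ t u)                        ≡⟨ cong (renΛ f) (sub1Λ-as-subΛ t u) ⟩
  renΛ f (subΛ (single u) t)                ≡⟨ renΛ-subΛ renΛ∘single t ⟩
  subΛ θ t                                  ≡⟨ sym (subΛ-renΛ single∘ext t) ⟩
  subΛ (single (renΛ f u)) (renΛ (ext f) t) ≡⟨ sym (sub1Λ-as-subΛ (renΛ (ext f) t) (renΛ f u)) ⟩
  sub1Λ (renΛ (ext f) t) (renΛ f u)         ∎
  where
  open ≡-Reasoning
  θ : Fin (suc m) → Λ n
  θ zero    = renΛ f u
  θ (suc i) = var (f i)
  renΛ∘single : renΛ f ∘ single u ≗ θ
  renΛ∘single zero    = refl
  renΛ∘single (suc i) = refl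
  single∘ext : single (renΛ f u) ∘ ext f ≗ θ
  single∘ext zero    = refl
  single∘ext (suc i) = refl

β-≡ : {t : Λ (suc n)} {u M : Λ n} → sub1Λ t u ≡ M → app (lam t) u ⟶β M
β-≡ refl = β

renΛ-⟶β : (f : Fin m → Fin n) {M N : Λ m} → M ⟶β N → renΛ f M ⟶β renΛ f N
renΛ-⟶β f (β {t} {u}) = β-≡ (sym (renΛ-sub1Λ f t u))
renΛ-⟶β f (ξlam M⟶N)  = ξlam (renΛ-⟶β (ext f) M⟶N)
renΛ-⟶β f (ξappₗ M⟶N) = ξappₗ (renΛ-⟶β f M⟶N)
renΛ-⟶β f (ξappᵣ M⟶N) = ξappᵣ (renΛ-⟶β f M⟶N)

wkΛ-⟶β : {M N : Λ n} → M ⟶β N → wkΛ M ⟶β wkΛ N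
wkΛ-⟶β = renΛ-⟶β suc

infix 4 _⟶β*_
_⟶β*_ : Λ n → Λ n → Set
_⟶β*_ = Star _⟶β_

⟶β⁺⇒⟶β* : {M N : Λ n} → M ⟶β⁺ N → M ⟶β* N
⟶β⁺⇒⟶β* [ M⟶N ]      = M⟶N ◅ ε
⟶β⁺⇒⟶β* (M⟶L ∷ L⟶⁺N) = M⟶L ◅ ⟶β⁺⇒⟶β* L⟶⁺N

≡⇒⟶β* : {M N : Λ n} → M ≡ N → M ⟶β* N
≡⇒⟶β* refl = ε

infixr 5 _⁺◅◅_

_⁺◅◅_ : {M N P : Λ n} → M ⟶β⁺ N → N ⟶β* P → M ⟶β⁺ P
[ M⟶N ]      ⁺◅◅ ε             = [ M⟶N ]
[ M⟶N ]      ⁺◅◅ (N⟶L ◅ L⟶*P) = M⟶N ∷ ([ N⟶L ] ⁺◅◅ L⟶*P)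
(M⟶L ∷ L⟶⁺N) ⁺◅◅ N⟶*P         = M⟶L ∷ (L⟶⁺N ⁺◅◅ N⟶*P)

⟶β⁺-map : (F : Λ m → Λ n) → (∀ {M N} → M ⟶β N → F M ⟶β F N) →
           ∀ {M N} → M ⟶β⁺ N → F M ⟶β⁺ F N
⟶β⁺-map F F-step [ M⟶N ]      = [ F-step M⟶N ]
⟶β⁺-map F F-step (M⟶L ∷ L⟶⁺N) = F-step M⟶L ∷ ⟶β⁺-map F F-step L⟶⁺N

ξappₗ-lam⁺ : {M M' : Λ (suc n)} (N : Λ n) → M ⟶β⁺ M' → app (lam M) N ⟶β⁺ app (lam M') N
ξappₗ-lam⁺ N = ⟶β⁺-map (λ M → app (lam M) N) (λ M⟶M' → ξappₗ (ξlam M⟶M'))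

⟶β⁺-bind : {F : Λ m → Λ n} → (∀ {M N} → M ⟶β N → F M ⟶β⁺ F N) →
           ∀ {M N} → M ⟶β⁺ N → F M ⟶β⁺ F N
⟶β⁺-bind F-step [ M⟶N ]      = F-step M⟶N
⟶β⁺-bind F-step (M⟶L ∷ L⟶⁺N) = F-step M⟶L ++ ⟶β⁺-bind F-step L⟶⁺N

⟶β*-bind : {F : Λ m → Λ n} → (∀ {M N} → M ⟶β N → F M ⟶β⁺ F N) →
           ∀ {M N} → M ⟶β* N → F M ⟶β* F N
⟶β*-bind F-step ε              = ε
⟶β*-bind F-step (M⟶L ◅ L⟶*N) = ⟶β⁺⇒⟶β* (F-step M⟶L) ◅◅ ⟶β*-bind F-step L⟶*N

⟨_,_⟩ : Λ n → Λ n → Λ n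
⟨ A , B ⟩ = lam (app (app (var zero) (wkΛ A)) (wkΛ B))

subΛ-⟨,⟩ : (θ : Fin m → Λ n) (A B : Λ m) →
           subΛ θ ⟨ A , B ⟩ ≡ ⟨ subΛ θ A , subΛ θ B ⟩
subΛ-⟨,⟩ θ A B = cong lam
  (cong₂ (λ A' B' → app (app (var zero) A') B') (subΛ-extsΛ-wkΛ θ A) (subΛ-extsΛ-wkΛ θ B))

⟨,⟩-β : {A B F : Λ n} → app ⟨ A , B ⟩ F ⟶β app (app F A) B
⟨,⟩-β {A = A} {B} {F} = β-≡ (begin
  sub1Λ (app (app (var zero) (wkΛ A)) (wkΛ B)) F
    ≡⟨ sub1Λ-as-subΛ (app (app (var zero) (wkΛ A)) (wkΛ B)) F ⟩
  app (app F (subΛ (single F) (wkΛ A))) (subΛ (single F) (wkΛ B))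
    ≡⟨ cong₂ (λ A' B' → app (app F A') B') (subΛ-single-wkΛ F A) (subΛ-single-wkΛ F B) ⟩
  app (app F A) B ∎)
  where open ≡-Reasoning

⟨,⟩-⟶ₗ : {A A' B : Λ n} → A ⟶β A' → ⟨ A , B ⟩ ⟶β ⟨ A' , B ⟩
⟨,⟩-⟶ₗ A⟶A' = ξlam (ξappₗ (ξappᵣ (wkΛ-⟶β A⟶A')))

⟨,⟩-⟶ᵣ : {A B B' : Λ n} → B ⟶β B' → ⟨ A , B ⟩ ⟶β ⟨ A , B' ⟩
⟨,⟩-⟶ᵣ B⟶B' = ξlam (ξappᵣ (wkΛ-⟶β B⟶B'))

packλ : Λ (suc (suc n)) → Λ n
packλ B = lam (lam (app (var (suc zero)) B))

packλ-⟶ : {B B' : Λ (suc (suc n))} → B ⟶β B' → packλ B ⟶β packλ B'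
packλ-⟶ B⟶B' = ξlam (ξlam (ξappᵣ B⟶B'))

mutual
  subT-cong : {τ τ' : Fin m → Term n} → τ ≗ τ' → subT τ ≗ subT τ'
  subT-cong τ≗τ' (var x)   = τ≗τ' x
  subT-cong τ≗τ' (lam t)   = cong lam (subT-cong (extsT-cong τ≗τ') t)
  subT-cong τ≗τ' (brace c) = cong brace (subC-cong τ≗τ' c)

  subL-cong : {τ τ' : Fin m → Term n} → τ ≗ τ' → subL τ ≗ subL τ'
  subL-cong τ≗τ' nil        = refl
  subL-cong τ≗τ' (cons u l) = cong₂ cons (subT-cong τ≗τ' u) (subL-cong τ≗τ' l)
  subL-cong τ≗τ' (mu c)     = cong mu (subC-cong (extsT-cong τ≗τ') c)

  subC-cong : {τ τ' : Fin m → Term n} → τ ≗ τ' → subC τ ≗ subC τ'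
  subC-cong τ≗τ' (cmd t l) = cong₂ cmd (subT-cong τ≗τ' t) (subL-cong τ≗τ' l)

  extsT-cong : {τ τ' : Fin m → Term n} → τ ≗ τ' → extsT τ ≗ extsT τ'
  extsT-cong τ≗τ' zero    = refl
  extsT-cong τ≗τ' (suc i) = cong (renT suc) (τ≗τ' i)

extsT-var : {τ : Fin n → Term n} → τ ≗ var → extsT τ ≗ var
extsT-var τ≗var zero    = refl
extsT-var τ≗var (suc i) = cong (renT suc) (τ≗var i)

mutual
  subT-id : {τ : Fin n → Term n} → τ ≗ var → subT τ ≗ id
  subT-id τ≗var (var x)   = τ≗var x
  subT-id τ≗var (lam t)   = cong lam (subT-id (extsT-var τ≗var) t)
  subT-id τ≗var (brace c) = cong brace (subC-id τ≗var c)

  subL-id : {τ : Fin n → Term n} → τ ≗ var → subL τ ≗ id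
  subL-id τ≗var nil        = refl
  subL-id τ≗var (cons u l) = cong₂ cons (subT-id τ≗var u) (subL-id τ≗var l)
  subL-id τ≗var (mu c)     = cong mu (subC-id (extsT-var τ≗var) c)

  subC-id : {τ : Fin n → Term n} → τ ≗ var → subC τ ≗ id
  subC-id τ≗var (cmd t l) = cong₂ cmd (subT-id τ≗var t) (subL-id τ≗var l)

singleT : Term n → Fin (suc n) → Term n
singleT t zero    = t
singleT t (suc i) = var i

sub1C-as-subC : (c : Cmd (suc n)) (t : Term n) → sub1C c t ≡ subC (singleT t) c
sub1C-as-subC c t = subC-cong (λ { zero → refl ; (suc i) → refl }) c

++ₗ-identityʳ : (l : CoTerm n) → l ++ₗ nil ≡ l
++ₗ-identityʳ nil            = refl
++ₗ-identityʳ (cons u l)     = cong (cons u) (++ₗ-identityʳ l)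
++ₗ-identityʳ (mu (cmd t l)) = cong (mu ∘ cmd t) (++ₗ-identityʳ l)

module _ (s : Λ 0) where
  open CGPS s

  subΛ-⁺g : (θ : Fin m → Λ n) (G : Λ m) → subΛ θ (G ⁺g) ≡ subΛ θ G ⁺g
  subΛ-⁺g θ G = cong₂ app (subΛ-closedΛ θ s) refl

  module _ {θ : Fin n → Λ n'} {ρ : Fin m → Fin n} {ρ' : Fin m → Fin n'} where

    extsΛ-ext-renaming : θ ∘ ρ ≗ var ∘ ρ' → extsΛ θ ∘ ext ρ ≗ var ∘ ext ρ'
    extsΛ-ext-renaming θρ≗ρ' zero    = refl
    extsΛ-ext-renaming θρ≗ρ' (suc i) = cong wkΛ (θρ≗ρ' i)

    extsΛ-suc-renaming : θ ∘ ρ ≗ var ∘ ρ' →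
                         (λ i → extsΛ θ (suc (ρ i))) ≗ (λ i → var (suc (ρ' i)))
    extsΛ-suc-renaming θρ≗ρ' i = cong wkΛ (θρ≗ρ' i)

  mutual
    subΛ-trT-renaming : {θ : Fin n → Λ n'} {ρ : Fin m → Fin n} {ρ' : Fin m → Fin n'} →
      θ ∘ ρ ≗ var ∘ ρ' → ∀ t G K → subΛ θ (trT t ρ G K) ≡ trT t ρ' (subΛ θ G) (subΛ θ K)
    subΛ-trT-renaming {θ = θ} θρ≗ρ' (var x) G K =
      cong₂ app (cong₂ app (θρ≗ρ' x) (subΛ-⁺g θ G)) refl
    subΛ-trT-renaming {θ = θ} {ρ} {ρ'} θρ≗ρ' (lam t) G K =
      cong (λ M → app (lam M) (subΛ θ G)) (begin
      subΛ (extsΛ θ) (wkΛ (app K (packλ (barT t (ext (suc ∘ ρ))))))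
        ≡⟨ subΛ-extsΛ-wkΛ θ (app K (packλ (barT t (ext (suc ∘ ρ))))) ⟩
      wkΛ (app (subΛ θ K) (packλ (subΛ (extsΛ (extsΛ θ)) (barT t (ext (suc ∘ ρ))))))
        ≡⟨ cong (λ B → wkΛ (app (subΛ θ K) (packλ B)))
                (subΛ-barT-renaming (extsΛ-ext-renaming (extsΛ-suc-renaming {θ = θ} {ρ} θρ≗ρ')) t) ⟩
      wkΛ (app (subΛ θ K) (packλ (barT t (ext (suc ∘ ρ')))))
        ∎)
      where open ≡-Reasoning
    subΛ-trT-renaming {θ = θ} {ρ' = ρ'} θρ≗ρ' (brace c) G K =
      trans (subΛ-trC-renaming θρ≗ρ' c (G ⁺g) K)
            (cong (λ G' → trC c ρ' G' (subΛ θ K)) (subΛ-⁺g θ G))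

    subΛ-barT-renaming : {θ : Fin n → Λ n'} {ρ : Fin m → Fin n} {ρ' : Fin m → Fin n'} →
      θ ∘ ρ ≗ var ∘ ρ' → ∀ t → subΛ θ (barT t ρ) ≡ barT t ρ'
    subΛ-barT-renaming {θ = θ} {ρ} θρ≗ρ' t = cong (λ M → lam (lam M))
      (subΛ-trT-renaming (extsΛ-suc-renaming {θ = extsΛ θ} (extsΛ-suc-renaming {θ = θ} {ρ} θρ≗ρ')) t _ _)

    subΛ-pairK-renaming : {θ : Fin n → Λ n'} {ρ : Fin m → Fin n} {ρ' : Fin m → Fin n'} →
      θ ∘ ρ ≗ var ∘ ρ' → ∀ l u G K →
      subΛ θ (pairK l u ρ G K) ≡ pairK l u ρ' (subΛ θ G) (subΛ θ K)
    subΛ-pairK-renaming {θ = θ} {ρ} θρ≗ρ' l u G K =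
      trans (subΛ-⟨,⟩ θ (trL l ρ G K) (barT u ρ))
            (cong₂ ⟨_,_⟩ (subΛ-trL-renaming θρ≗ρ' l G K) (subΛ-barT-renaming θρ≗ρ' u))

    subΛ-trL-renaming : {θ : Fin n → Λ n'} {ρ : Fin m → Fin n} {ρ' : Fin m → Fin n'} →
      θ ∘ ρ ≗ var ∘ ρ' → ∀ l G K → subΛ θ (trL l ρ G K) ≡ trL l ρ' (subΛ θ G) (subΛ θ K)
    subΛ-trL-renaming {θ = θ} θρ≗ρ' nil G K = subΛ-⟨,⟩ θ G K
    subΛ-trL-renaming {θ = θ} {ρ} θρ≗ρ' (cons u l) G K =
      trans (subΛ-⟨,⟩ θ G (pairK l u ρ G K))
            (cong ⟨ subΛ θ G ,_⟩ (subΛ-pairK-renaming θρ≗ρ' l u G K))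
    subΛ-trL-renaming {θ = θ} {ρ} {ρ'} θρ≗ρ' (mu c) G K = cong lam (trans
      (subΛ-trC-renaming (extsΛ-ext-renaming {θ = θ} {ρ} θρ≗ρ') c (wkΛ G) (wkΛ K))
      (cong₂ (trC c (ext ρ')) (subΛ-extsΛ-wkΛ θ G) (subΛ-extsΛ-wkΛ θ K)))

    subΛ-trC-renaming : {θ : Fin n → Λ n'} {ρ : Fin m → Fin n} {ρ' : Fin m → Fin n'} →
      θ ∘ ρ ≗ var ∘ ρ' → ∀ c G K → subΛ θ (trC c ρ G K) ≡ trC c ρ' (subΛ θ G) (subΛ θ K)
    subΛ-trC-renaming θρ≗ρ' (cmd t nil) G K = subΛ-trT-renaming θρ≗ρ' t G K
    subΛ-trC-renaming {ρ' = ρ'} θρ≗ρ' (cmd t (cons u l)) G K =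
      trans (subΛ-trT-renaming θρ≗ρ' t G _)
            (cong (trT t ρ' _) (subΛ-pairK-renaming θρ≗ρ' l u G K))
    subΛ-trC-renaming θρ≗ρ' (cmd t (mu c)) G K =
      cong₂ app (subΛ-trL-renaming θρ≗ρ' (mu c) G K) (subΛ-barT-renaming θρ≗ρ' t)

  renΛ-barT : (f : Fin n → Fin n') {ρ : Fin m → Fin n} (t : Term m) →
              renΛ f (barT t ρ) ≡ barT t (f ∘ ρ)
  renΛ-barT f t = trans (renΛ-as-subΛ f _) (subΛ-barT-renaming (λ _ → refl) t)

  renΛ-trL : (f : Fin n → Fin n') {ρ : Fin m → Fin n} (l : CoTerm m) (G K : Λ n) →
             renΛ f (trL l ρ G K) ≡ trL l (f ∘ ρ) (renΛ f G) (renΛ f K)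
  renΛ-trL f {ρ} l G K = begin
    renΛ f (trL l ρ G K)                                ≡⟨ renΛ-as-subΛ f _ ⟩
    subΛ (var ∘ f) (trL l ρ G K)                        ≡⟨ subΛ-trL-renaming (λ _ → refl) l G K ⟩
    trL l (f ∘ ρ) (subΛ (var ∘ f) G) (subΛ (var ∘ f) K)
      ≡⟨ sym (cong₂ (trL l (f ∘ ρ)) (renΛ-as-subΛ f G) (renΛ-as-subΛ f K)) ⟩
    trL l (f ∘ ρ) (renΛ f G) (renΛ f K)                 ∎
    where open ≡-Reasoning

  renΛ-pairK : (f : Fin n → Fin n') {ρ : Fin m → Fin n} (l : CoTerm m) (u : Term m) (G K : Λ n) →
               renΛ f (pairK l u ρ G K) ≡ pairK l u (f ∘ ρ) (renΛ f G) (renΛ f K)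
  renΛ-pairK f {ρ} l u G K = begin
    renΛ f (pairK l u ρ G K)                                ≡⟨ renΛ-as-subΛ f _ ⟩
    subΛ (var ∘ f) (pairK l u ρ G K)                        ≡⟨ subΛ-pairK-renaming (λ _ → refl) l u G K ⟩
    pairK l u (f ∘ ρ) (subΛ (var ∘ f) G) (subΛ (var ∘ f) K)
      ≡⟨ sym (cong₂ (pairK l u (f ∘ ρ)) (renΛ-as-subΛ f G) (renΛ-as-subΛ f K)) ⟩
    pairK l u (f ∘ ρ) (renΛ f G) (renΛ f K)                 ∎
    where open ≡-Reasoning

  mutual
    trT-renT : {f : Fin m → Fin m'} {ρ : Fin m' → Fin n} {ρ' : Fin m → Fin n} →
      ρ ∘ f ≗ ρ' → ∀ t G K → trT (renT f t) ρ G K ≡ trT t ρ' G K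
    trT-renT ρf≗ρ' (var x) G K = cong (λ y → app (app (var y) (G ⁺g)) K) (ρf≗ρ' x)
    trT-renT ρf≗ρ' (lam t) G K = cong (λ B → app (lam (wkΛ (app K (packλ B)))) G)
      (barT-renT (ext-∘ (λ x → cong suc (ρf≗ρ' x))) t)
    trT-renT ρf≗ρ' (brace c) G K = trC-renC ρf≗ρ' c (G ⁺g) K

    barT-renT : {f : Fin m → Fin m'} {ρ : Fin m' → Fin n} {ρ' : Fin m → Fin n} →
      ρ ∘ f ≗ ρ' → ∀ t → barT (renT f t) ρ ≡ barT t ρ'
    barT-renT ρf≗ρ' t =
      cong (λ M → lam (lam M)) (trT-renT (λ x → cong (λ y → suc (suc y)) (ρf≗ρ' x)) t _ _)

    pairK-renL : {f : Fin m → Fin m'} {ρ : Fin m' → Fin n} {ρ' : Fin m → Fin n} →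
      ρ ∘ f ≗ ρ' → ∀ l u G K → pairK (renL f l) (renT f u) ρ G K ≡ pairK l u ρ' G K
    pairK-renL ρf≗ρ' l u G K = cong₂ ⟨_,_⟩ (trL-renL ρf≗ρ' l G K) (barT-renT ρf≗ρ' u)

    trL-renL : {f : Fin m → Fin m'} {ρ : Fin m' → Fin n} {ρ' : Fin m → Fin n} →
      ρ ∘ f ≗ ρ' → ∀ l G K → trL (renL f l) ρ G K ≡ trL l ρ' G K
    trL-renL ρf≗ρ' nil        G K = refl
    trL-renL ρf≗ρ' (cons u l) G K = cong ⟨ G ,_⟩ (pairK-renL ρf≗ρ' l u G K)
    trL-renL ρf≗ρ' (mu c)     G K = cong lam (trC-renC (ext-∘ ρf≗ρ') c _ _)

    trC-renC : {f : Fin m → Fin m'} {ρ : Fin m' → Fin n} {ρ' : Fin m → Fin n} →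
      ρ ∘ f ≗ ρ' → ∀ c G K → trC (renC f c) ρ G K ≡ trC c ρ' G K
    trC-renC ρf≗ρ' (cmd t nil)        G K = trT-renT ρf≗ρ' t G K
    trC-renC {ρ' = ρ'} ρf≗ρ' (cmd t (cons u l)) G K =
      trans (trT-renT ρf≗ρ' t G _) (cong (trT t ρ' G) (pairK-renL ρf≗ρ' l u G K))
    trC-renC ρf≗ρ' (cmd t (mu c))     G K =
      cong₂ app (trL-renL ρf≗ρ' (mu c) G K) (barT-renT ρf≗ρ' t)

  wkΛ-trL : {ρ : Fin m → Fin n} (l : CoTerm m) (G K : Λ n) →
            wkΛ (trL l ρ G K) ≡ trL (renL suc l) (ext ρ) (wkΛ G) (wkΛ K)
  wkΛ-trL l G K = trans (renΛ-trL suc l G K) (sym (trL-renL (λ _ → refl) l _ _))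

  wkΛ-pairK : {ρ : Fin m → Fin n} (l : CoTerm m) (u : Term m) (G K : Λ n) →
              wkΛ (pairK l u ρ G K) ≡ pairK (renL suc l) (renT suc u) (ext ρ) (wkΛ G) (wkΛ K)
  wkΛ-pairK l u G K = trans (renΛ-pairK suc l u G K) (sym (pairK-renL (λ _ → refl) l u _ _))

  mutual
    trT-⟶K : (t : Term m) {ρ : Fin m → Fin n} {G K K' : Λ n} →
             K ⟶β K' → trT t ρ G K ⟶β⁺ trT t ρ G K'
    trT-⟶K (var x)   K⟶K' = [ ξappᵣ K⟶K' ]
    trT-⟶K (lam t)   K⟶K' = [ ξappₗ (ξlam (wkΛ-⟶β (ξappₗ K⟶K'))) ]
    trT-⟶K (brace c) K⟶K' = trC-⟶K c K⟶K'

    trC-⟶K : (c : Cmd m) {ρ : Fin m → Fin n} {G K K' : Λ n} →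
             K ⟶β K' → trC c ρ G K ⟶β⁺ trC c ρ G K'
    trC-⟶K (cmd t nil)            K⟶K' = trT-⟶K t K⟶K'
    trC-⟶K (cmd t (cons u l))     K⟶K' = ⟶β⁺-bind (trT-⟶K t) (pairK-⟶K l u K⟶K')
    trC-⟶K (cmd t (mu c)) {ρ} K⟶K' = ξappₗ-lam⁺ (barT t ρ) (trC-⟶K c (wkΛ-⟶β K⟶K'))

    trL-⟶K : (l : CoTerm m) {ρ : Fin m → Fin n} {G K K' : Λ n} →
             K ⟶β K' → trL l ρ G K ⟶β⁺ trL l ρ G K'
    trL-⟶K nil                  K⟶K' = [ ⟨,⟩-⟶ᵣ K⟶K' ]
    trL-⟶K (cons u l) {G = G}   K⟶K' = ⟶β⁺-map ⟨ G ,_⟩ ⟨,⟩-⟶ᵣ (pairK-⟶K l u K⟶K')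
    trL-⟶K (mu c)               K⟶K' = ⟶β⁺-map lam ξlam (trC-⟶K c (wkΛ-⟶β K⟶K'))

    pairK-⟶K : (l : CoTerm m) (u : Term m) {ρ : Fin m → Fin n} {G K K' : Λ n} →
               K ⟶β K' → pairK l u ρ G K ⟶β⁺ pairK l u ρ G K'
    pairK-⟶K l u {ρ} K⟶K' = ⟶β⁺-map ⟨_, barT u ρ ⟩ ⟨,⟩-⟶ₗ (trL-⟶K l K⟶K')

  trT-⟶⁺K : (t : Term m) {ρ : Fin m → Fin n} {G K K' : Λ n} →
            K ⟶β⁺ K' → trT t ρ G K ⟶β⁺ trT t ρ G K'
  trT-⟶⁺K t = ⟶β⁺-bind (trT-⟶K t)

  trT-⟶*K : (t : Term m) {ρ : Fin m → Fin n} {G K K' : Λ n} →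
            K ⟶β* K' → trT t ρ G K ⟶β* trT t ρ G K'
  trT-⟶*K t = ⟶β*-bind (trT-⟶K t)

  mutual
    trT-⟶G : (t : Term m) {ρ : Fin m → Fin n} {G G' K : Λ n} →
             G ⟶β G' → trT t ρ G K ⟶β⁺ trT t ρ G' K
    trT-⟶G (var x)   G⟶G' = [ ξappₗ (ξappᵣ (ξappᵣ G⟶G')) ]
    trT-⟶G (lam t)   G⟶G' = [ ξappᵣ G⟶G' ]
    trT-⟶G (brace c) G⟶G' = trC-⟶G c (ξappᵣ G⟶G')

    trC-⟶G : (c : Cmd m) {ρ : Fin m → Fin n} {G G' K : Λ n} →
             G ⟶β G' → trC c ρ G K ⟶β⁺ trC c ρ G' K
    trC-⟶G (cmd t nil)            G⟶G' = trT-⟶G t G⟶G'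
    trC-⟶G (cmd t (cons u l))     G⟶G' = trT-⟶G t G⟶G' ++ trT-⟶⁺K t (pairK-⟶G l u G⟶G')
    trC-⟶G (cmd t (mu c)) {ρ} G⟶G' = ξappₗ-lam⁺ (barT t ρ) (trC-⟶G c (wkΛ-⟶β G⟶G'))

    trL-⟶G : (l : CoTerm m) {ρ : Fin m → Fin n} {G G' K : Λ n} →
             G ⟶β G' → trL l ρ G K ⟶β⁺ trL l ρ G' K
    trL-⟶G nil                  G⟶G' = [ ⟨,⟩-⟶ₗ G⟶G' ]
    trL-⟶G (cons u l) {G' = G'} G⟶G' =
      ⟨,⟩-⟶ₗ G⟶G' ∷ ⟶β⁺-map ⟨ G' ,_⟩ ⟨,⟩-⟶ᵣ (pairK-⟶G l u G⟶G')
    trL-⟶G (mu c)               G⟶G' = ⟶β⁺-map lam ξlam (trC-⟶G c (wkΛ-⟶β G⟶G'))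

    pairK-⟶G : (l : CoTerm m) (u : Term m) {ρ : Fin m → Fin n} {G G' K : Λ n} →
               G ⟶β G' → pairK l u ρ G K ⟶β⁺ pairK l u ρ G' K
    pairK-⟶G l u {ρ} G⟶G' = ⟶β⁺-map ⟨_, barT u ρ ⟩ ⟨,⟩-⟶ₗ (trL-⟶G l G⟶G')

  trT-⟶⁺G : (t : Term m) {ρ : Fin m → Fin n} {G G' K : Λ n} →
            G ⟶β⁺ G' → trT t ρ G K ⟶β⁺ trT t ρ G' K
  trT-⟶⁺G t = ⟶β⁺-bind (trT-⟶G t)

  trC-⟶⁺G : (c : Cmd m) {ρ : Fin m → Fin n} {G G' K : Λ n} →
            G ⟶β⁺ G' → trC c ρ G K ⟶β⁺ trC c ρ G' K
  trC-⟶⁺G c = ⟶β⁺-bind (trC-⟶G c)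

  barT-β : (t : Term m) (ρ : Fin m → Fin n) (G K : Λ n) →
           app (app (barT t ρ) G) K ⟶β⁺ trT t ρ G K
  barT-β t ρ G K = ξappₗ (β-≡ substG) ∷ [ β-≡ substK ]
    where
    substG : sub1Λ (lam (trT t (fs ∘ fs ∘ ρ) (var (suc zero)) (var zero))) G
             ≡ lam (trT t (suc ∘ ρ) (wkΛ G) (var zero))
    substG = trans (sub1Λ-as-subΛ (lam (trT t (fs ∘ fs ∘ ρ) (var (suc zero)) (var zero))) G)
                   (cong lam (subΛ-trT-renaming (λ _ → refl) t _ _))
    substK : sub1Λ (trT t (suc ∘ ρ) (wkΛ G) (var zero)) K ≡ trT t ρ G K
    substK = trans (sub1Λ-as-subΛ (trT t (suc ∘ ρ) (wkΛ G) (var zero)) K)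
                   (trans (subΛ-trT-renaming {θ = single K} (λ _ → refl) t _ _)
                          (cong (λ G' → trT t ρ G' K) (subΛ-single-wkΛ K G)))

  ⟨,⟩-barT-β : (t : Term m) (ρ : Fin m → Fin n) (G K : Λ n) →
               app ⟨ G , K ⟩ (barT t ρ) ⟶β⁺ trT t ρ G K
  ⟨,⟩-barT-β t ρ G K = ⟨,⟩-β ∷ barT-β t ρ G K

  trL-app-barT : (l : CoTerm m) (t : Term m) (ρ : Fin m → Fin n) (G K : Λ n) →
                 app (trL l ρ G K) (barT t ρ) ⟶β* trC (cmd t l) ρ G K
  trL-app-barT nil        t ρ G K = ⟶β⁺⇒⟶β* (⟨,⟩-barT-β t ρ G K)
  trL-app-barT (cons u l) t ρ G K = ⟶β⁺⇒⟶β* (⟨,⟩-barT-β t ρ G (pairK l u ρ G K))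
  trL-app-barT (mu c)     t ρ G K = ε

  packλ-barT-β : (t : Term (suc m)) (ρ : Fin m → Fin n) (L : Λ n) →
                 app (packλ (barT t (ext (suc ∘ ρ)))) L ⟶β lam (app (wkΛ L) (barT t (ext ρ)))
  packλ-barT-β {n = n} t ρ L = β-≡ (trans (sub1Λ-as-subΛ (lam (app (var (suc zero)) B)) L)
    (cong (λ B' → lam (app (wkΛ L) B')) (subΛ-barT-renaming shifts t)))
    where
    shifts : extsΛ (single L) ∘ ext (suc ∘ ρ) ≗ var ∘ ext ρ
    shifts zero    = refl
    shifts (suc i) = refl
    B : Λ (suc (suc n))
    B = barT t (ext (suc ∘ ρ))

  mutual
    trL-++ₗ : ∀ l {ρ : Fin m → Fin n} {G K : Λ n} {l' : CoTerm m} {u : Term m} →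
              trL l ρ G (pairK l' u ρ G K) ≡ trL (l ++ₗ cons u l') ρ G K
    trL-++ₗ nil                                 = refl
    trL-++ₗ (cons v l) {G = G}                  = cong ⟨ G ,_⟩ (pairK-++ₗ l v)
    trL-++ₗ (mu (cmd t l)) {ρ} {G} {K} {l'} {u} = cong lam
      (trans (cong (trC (cmd t l) (ext ρ) (wkΛ G)) (wkΛ-pairK l' u G K)) (trC-++ₗ t l))

    pairK-++ₗ : ∀ l v {ρ : Fin m → Fin n} {G K : Λ n} {l' : CoTerm m} {u : Term m} →
                pairK l v ρ G (pairK l' u ρ G K) ≡ pairK (l ++ₗ cons u l') v ρ G K
    pairK-++ₗ l v {ρ} = cong ⟨_, barT v ρ ⟩ (trL-++ₗ l)

    trC-++ₗ : ∀ t l {ρ : Fin m → Fin n} {G K : Λ n} {l' : CoTerm m} {u : Term m} →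
              trC (cmd t l) ρ G (pairK l' u ρ G K) ≡ trC (cmd t (l ++ₗ cons u l')) ρ G K
    trC-++ₗ t nil                 = refl
    trC-++ₗ t (cons v l) {ρ} {G}  = cong (trT t ρ G) (pairK-++ₗ l v)
    trC-++ₗ t (mu (cmd t' l)) {ρ} = cong (λ L → app L (barT t ρ)) (trL-++ₗ (mu (cmd t' l)))

  -- Binders crossed by the substitution stay variables; a substituted variable becomes t̄.
  data SimulatesAt {m m' n n'} (θ : Fin n → Λ n') (ρ : Fin m → Fin n)
                   (τ : Fin m → Term m') (ρ' : Fin m' → Fin n') (x : Fin m) : Set where
    var↦var : ∀ {y} → τ x ≡ var y → θ (ρ x) ≡ var (ρ' y) → SimulatesAt θ ρ τ ρ' x
    ↦barT   : θ (ρ x) ≡ barT (τ x) ρ' → SimulatesAt θ ρ τ ρ' x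

  Simulates : (Fin n → Λ n') → (Fin m → Fin n) → (Fin m → Term m') → (Fin m' → Fin n') → Set
  Simulates θ ρ τ ρ' = ∀ x → SimulatesAt θ ρ τ ρ' x

  module _ {θ : Fin n → Λ n'} {ρ : Fin m → Fin n} {τ : Fin m → Term m'} {ρ' : Fin m' → Fin n'}
           where

    Simulates-suc : Simulates θ ρ τ ρ' → Simulates (extsΛ θ) (suc ∘ ρ) τ (suc ∘ ρ')
    Simulates-suc sim x with sim x
    ... | var↦var τx≡y θρx≡y = var↦var τx≡y (cong wkΛ θρx≡y)
    ... | ↦barT θρx≡barT     = ↦barT (trans (cong wkΛ θρx≡barT) (renΛ-barT suc (τ x)))

    Simulates-ext : Simulates θ ρ τ ρ' → Simulates (extsΛ θ) (ext ρ) (extsT τ) (ext ρ')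
    Simulates-ext sim zero = var↦var refl refl
    Simulates-ext sim (suc x) with sim x
    ... | var↦var τx≡y θρx≡y = var↦var (cong (renT suc) τx≡y) (cong wkΛ θρx≡y)
    ... | ↦barT θρx≡barT     = ↦barT (begin
      wkΛ (θ (ρ x))                  ≡⟨ cong wkΛ θρx≡barT ⟩
      wkΛ (barT (τ x) ρ')            ≡⟨ renΛ-barT suc (τ x) ⟩
      barT (τ x) (suc ∘ ρ')          ≡⟨ sym (barT-renT (λ _ → refl) (τ x)) ⟩
      barT (renT suc (τ x)) (ext ρ') ∎)
      where open ≡-Reasoning

  Simulates-single : (t : Term m) (ρ : Fin m → Fin n) →
                     Simulates (single (barT t ρ)) (ext ρ) (singleT t) ρ
  Simulates-single t ρ zero    = ↦barT refl
  Simulates-single t ρ (suc x) = var↦var refl refl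

  module _ (sG⟶G : ∀ {n} (G : Λ n) → (G ⁺g) ⟶β⁺ G) where

    mutual
      subΛ-trT-subT :
        {θ : Fin n → Λ n'} {ρ : Fin m → Fin n} {τ : Fin m → Term m'} {ρ' : Fin m' → Fin n'} →
        Simulates θ ρ τ ρ' → ∀ t G K →
        subΛ θ (trT t ρ G K) ⟶β* trT (subT τ t) ρ' (subΛ θ G) (subΛ θ K)
      subΛ-trT-subT {θ = θ} {τ = τ} {ρ'} sim (var x) G K with sim x
      ... | var↦var τx≡y θρx≡y rewrite τx≡y =
        ≡⇒⟶β* (cong₂ app (cong₂ app θρx≡y (subΛ-⁺g θ G)) refl)
      ... | ↦barT θρx≡barT =
        -- x G⁺ K has become t̄ G⁺ K, which reaches (t : G,K) only through the s-redex in G⁺.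
        ≡⇒⟶β* (cong₂ app (cong₂ app θρx≡barT (subΛ-⁺g θ G)) refl)
        ◅◅ ⟶β⁺⇒⟶β* (barT-β (τ x) ρ' _ (subΛ θ K) ++ trT-⟶⁺G (τ x) (sG⟶G (subΛ θ G)))
      subΛ-trT-subT {θ = θ} {ρ} {τ} {ρ'} sim (lam t) G K =
        ≡⇒⟶β* (cong (λ M → app (lam M) (subΛ θ G))
                    (subΛ-extsΛ-wkΛ θ (app K (packλ (barT t (ext (suc ∘ ρ)))))))
        ◅◅ Star.gmap (λ B → app (lam (wkΛ (app (subΛ θ K) (packλ B)))) (subΛ θ G))
             (λ B⟶B' → ξappₗ (ξlam (wkΛ-⟶β (ξappᵣ (packλ-⟶ B⟶B')))))
             (subΛ-barT-subT (Simulates-ext (Simulates-suc {θ = θ} {ρ} {τ} {ρ'} sim)) t)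
      subΛ-trT-subT {θ = θ} {τ = τ} {ρ'} sim (brace c) G K =
        subΛ-trC-subT sim c (G ⁺g) K
        ◅◅ ≡⇒⟶β* (cong (λ G' → trC (subC τ c) ρ' G' (subΛ θ K)) (subΛ-⁺g θ G))

      subΛ-barT-subT :
        {θ : Fin n → Λ n'} {ρ : Fin m → Fin n} {τ : Fin m → Term m'} {ρ' : Fin m' → Fin n'} →
        Simulates θ ρ τ ρ' → ∀ t → subΛ θ (barT t ρ) ⟶β* barT (subT τ t) ρ'
      subΛ-barT-subT {θ = θ} {ρ} {τ} {ρ'} sim t =
        Star.gmap (λ M → lam (lam M)) (λ M⟶N → ξlam (ξlam M⟶N))
        (subΛ-trT-subT (Simulates-suc {θ = extsΛ θ} (Simulates-suc {θ = θ} {ρ} {τ} {ρ'} sim)) t _ _)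

      subΛ-pairK-subT :
        {θ : Fin n → Λ n'} {ρ : Fin m → Fin n} {τ : Fin m → Term m'} {ρ' : Fin m' → Fin n'} →
        Simulates θ ρ τ ρ' → ∀ l u G K →
        subΛ θ (pairK l u ρ G K) ⟶β* pairK (subL τ l) (subT τ u) ρ' (subΛ θ G) (subΛ θ K)
      subΛ-pairK-subT {θ = θ} {ρ} {τ} {ρ'} sim l u G K =
        ≡⇒⟶β* (subΛ-⟨,⟩ θ (trL l ρ G K) (barT u ρ))
        ◅◅ Star.gmap ⟨_, subΛ θ (barT u ρ) ⟩ ⟨,⟩-⟶ₗ (subΛ-trL-subT sim l G K)
        ◅◅ Star.gmap ⟨ trL (subL τ l) ρ' (subΛ θ G) (subΛ θ K) ,_⟩ ⟨,⟩-⟶ᵣ (subΛ-barT-subT sim u)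

      subΛ-trL-subT :
        {θ : Fin n → Λ n'} {ρ : Fin m → Fin n} {τ : Fin m → Term m'} {ρ' : Fin m' → Fin n'} →
        Simulates θ ρ τ ρ' → ∀ l G K →
        subΛ θ (trL l ρ G K) ⟶β* trL (subL τ l) ρ' (subΛ θ G) (subΛ θ K)
      subΛ-trL-subT {θ = θ} sim nil G K = ≡⇒⟶β* (subΛ-⟨,⟩ θ G K)
      subΛ-trL-subT {θ = θ} {ρ} sim (cons u l) G K =
        ≡⇒⟶β* (subΛ-⟨,⟩ θ G (pairK l u ρ G K))
        ◅◅ Star.gmap ⟨ subΛ θ G ,_⟩ ⟨,⟩-⟶ᵣ (subΛ-pairK-subT sim l u G K)
      subΛ-trL-subT {θ = θ} {ρ} {τ} {ρ'} sim (mu c) G K = Star.gmap lam ξlam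
        (subΛ-trC-subT (Simulates-ext {θ = θ} {ρ} {τ} {ρ'} sim) c (wkΛ G) (wkΛ K)
         ◅◅ ≡⇒⟶β* (cong₂ (trC (subC (extsT τ) c) (ext ρ'))
                         (subΛ-extsΛ-wkΛ θ G) (subΛ-extsΛ-wkΛ θ K)))

      subΛ-trC-subT :
        {θ : Fin n → Λ n'} {ρ : Fin m → Fin n} {τ : Fin m → Term m'} {ρ' : Fin m' → Fin n'} →
        Simulates θ ρ τ ρ' → ∀ c G K →
        subΛ θ (trC c ρ G K) ⟶β* trC (subC τ c) ρ' (subΛ θ G) (subΛ θ K)
      subΛ-trC-subT sim (cmd t nil)        G K = subΛ-trT-subT sim t G K
      subΛ-trC-subT {τ = τ} sim (cmd t (cons u l)) G K =
        subΛ-trT-subT sim t G _ ◅◅ trT-⟶*K (subT τ t) (subΛ-pairK-subT sim l u G K)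
      subΛ-trC-subT {θ = θ} {ρ} {τ} {ρ'} sim (cmd t (mu c)) G K =
        Star.gmap (λ L → app L (subΛ θ (barT t ρ))) ξappₗ (subΛ-trL-subT sim (mu c) G K)
        ◅◅ Star.gmap (app (trL (subL τ (mu c)) ρ' (subΛ θ G) (subΛ θ K))) ξappᵣ
                     (subΛ-barT-subT sim t)

    trL-μ : (l : CoTerm m) (ρ : Fin m → Fin n) (G K : Λ n) →
            trL (mu (cmd (var zero) (renL suc l))) ρ G K ⟶β⁺ trL l ρ G K
    trL-μ nil ρ G K =
      ⟶β⁺-map (λ G' → lam (app (app (var zero) G') (wkΛ K)))
              (λ G⟶G' → ξlam (ξappₗ (ξappᵣ G⟶G')))
        (sG⟶G (wkΛ G))
    trL-μ {n = n} (cons u l) ρ G K =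
      ⟶β⁺-map (λ G' → lam (app (app (var zero) G') P'))
              (λ G⟶G' → ξlam (ξappₗ (ξappᵣ G⟶G')))
        (sG⟶G (wkΛ G))
      ⁺◅◅ ≡⇒⟶β* (cong (λ P → lam (app (app (var zero) (wkΛ G)) P)) (sym (wkΛ-pairK l u G K)))
      where
      P' : Λ (suc n)
      P' = pairK (renL suc l) (renT suc u) (ext ρ) (wkΛ G) (wkΛ K)
    trL-μ {n = n} (mu c) ρ G K =
      [ ξlam (β-≡ unrenamed) ]
      ⁺◅◅ Star.gmap lam ξlam (subΛ-trC-subT binder↦barT c G₂ K₂ ◅◅ ≡⇒⟶β* (trans
            (cong (λ c' → trC c' (ext ρ) (subΛ (single B₀) G₂) (subΛ (single B₀) K₂))
                  (subC-id (λ _ → refl) c))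
            (cong₂ (trC c (ext ρ)) (subΛ-single-wkΛ B₀ (wkΛ G)) (subΛ-single-wkΛ B₀ (wkΛ K)))))
      where
      B₀ : Λ (suc n)
      B₀ = barT (var zero) (ext ρ)
      G₂ K₂ : Λ (suc (suc n))
      G₂ = wkΛ (wkΛ G)
      K₂ = wkΛ (wkΛ K)
      unrenamed : sub1Λ (trC (renC (ext suc) c) (ext (ext ρ)) G₂ K₂) B₀
                ≡ subΛ (single B₀) (trC c (ext (suc ∘ ρ)) G₂ K₂)
      unrenamed = trans (sub1Λ-as-subΛ (trC (renC (ext suc) c) (ext (ext ρ)) G₂ K₂) B₀)
                        (cong (subΛ (single B₀)) (trC-renC (ext-∘ (λ _ → refl)) c G₂ K₂))
      binder↦barT : Simulates (single B₀) (ext (suc ∘ ρ)) var (ext ρ)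
      binder↦barT zero    = ↦barT refl
      binder↦barT (suc i) = var↦var refl refl

    mutual
      trT-⟶T : {t t' : Term m} → t ⟶T t' →
               (ρ : Fin m → Fin n) (G K : Λ n) → trT t ρ G K ⟶β⁺ trT t' ρ G K
      trT-⟶T (ε {t})        ρ G K = trT-⟶⁺G t (sG⟶G G)
      trT-⟶T (ξlam t⟶t')    ρ G K =
        ⟶β⁺-map (λ B → app (lam (wkΛ (app K (packλ B)))) G)
                (λ B⟶B' → ξappₗ (ξlam (wkΛ-⟶β (ξappᵣ (packλ-⟶ B⟶B')))))
                (barT-⟶T t⟶t' (ext (suc ∘ ρ)))
      trT-⟶T (ξbrace c⟶c')  ρ G K = trC-⟶C c⟶c' ρ (G ⁺g) K

      barT-⟶T : {t t' : Term m} → t ⟶T t' → (ρ : Fin m → Fin n) → barT t ρ ⟶β⁺ barT t' ρ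
      barT-⟶T t⟶t' ρ = ⟶β⁺-map (λ M → lam (lam M)) (λ M⟶N → ξlam (ξlam M⟶N))
                                (trT-⟶T t⟶t' _ (var (suc zero)) (var zero))

      pairK-⟶T : {u u' : Term m} → u ⟶T u' → (l : CoTerm m) (ρ : Fin m → Fin n) (G K : Λ n) →
                 pairK l u ρ G K ⟶β⁺ pairK l u' ρ G K
      pairK-⟶T u⟶u' l ρ G K = ⟶β⁺-map ⟨ trL l ρ G K ,_⟩ ⟨,⟩-⟶ᵣ (barT-⟶T u⟶u' ρ)

      pairK-⟶L : {l l' : CoTerm m} → l ⟶L l' → (u : Term m) (ρ : Fin m → Fin n) (G K : Λ n) →
                 pairK l u ρ G K ⟶β⁺ pairK l' u ρ G K
      pairK-⟶L l⟶l' u ρ G K = ⟶β⁺-map ⟨_, barT u ρ ⟩ ⟨,⟩-⟶ₗ (trL-⟶L l⟶l' ρ G K)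

      trL-⟶L : {l l' : CoTerm m} → l ⟶L l' →
               (ρ : Fin m → Fin n) (G K : Λ n) → trL l ρ G K ⟶β⁺ trL l' ρ G K
      trL-⟶L (μ {l})              ρ G K = trL-μ l ρ G K
      trL-⟶L (ξconsₗ {l = l} u⟶u') ρ G K = ⟶β⁺-map ⟨ G ,_⟩ ⟨,⟩-⟶ᵣ (pairK-⟶T u⟶u' l ρ G K)
      trL-⟶L (ξconsᵣ {u} l⟶l')    ρ G K = ⟶β⁺-map ⟨ G ,_⟩ ⟨,⟩-⟶ᵣ (pairK-⟶L l⟶l' u ρ G K)
      trL-⟶L (ξmu c⟶c')           ρ G K = ⟶β⁺-map lam ξlam (trC-⟶C c⟶c' (ext ρ) (wkΛ G) (wkΛ K))

      trC-⟶L : {l l' : CoTerm m} → l ⟶L l' → (t : Term m) (ρ : Fin m → Fin n) (G K : Λ n) →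
               trC (cmd t l) ρ G K ⟶β⁺ trC (cmd t l') ρ G K
      trC-⟶L (μ {l})              t ρ G K =
        ⟶β⁺-map (λ L → app L (barT t ρ)) ξappₗ (trL-μ l ρ G K) ⁺◅◅ trL-app-barT l t ρ G K
      trC-⟶L (ξconsₗ {l = l} u⟶u') t ρ G K = trT-⟶⁺K t (pairK-⟶T u⟶u' l ρ G K)
      trC-⟶L (ξconsᵣ {u} l⟶l')    t ρ G K = trT-⟶⁺K t (pairK-⟶L l⟶l' u ρ G K)
      trC-⟶L (ξmu c⟶c')           t ρ G K =
        ξappₗ-lam⁺ (barT t ρ) (trC-⟶C c⟶c' (ext ρ) (wkΛ G) (wkΛ K))

      trC-⟶C : {c c' : Cmd m} → c ⟶C c' →
               (ρ : Fin m → Fin n) (G K : Λ n) → trC c ρ G K ⟶β⁺ trC c' ρ G K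
      trC-⟶C {n = n} (β {t} {u} {l}) ρ G K =
        β-≡ (sub1Λ-wkΛ (app P F) G) ∷ ⟨,⟩-β ∷ [ ξappₗ (packλ-barT-β t ρ L) ]
        ⁺◅◅ Star.gmap (λ M → app (lam M) (barT u ρ)) (λ M⟶N → ξappₗ (ξlam M⟶N))
              (≡⇒⟶β* (cong (λ L' → app L' (barT t (ext ρ))) (wkΛ-trL l G K))
               ◅◅ trL-app-barT (renL suc l) t (ext ρ) (wkΛ G) (wkΛ K))
        where
        L P F : Λ n
        L = trL l ρ G K
        P = pairK l u ρ G K
        F = packλ (barT t (ext (suc ∘ ρ)))
      trC-⟶C (π {t} {l} nilE) ρ G K =
        trC-⟶⁺G (cmd t l) (sG⟶G G)
        ⁺◅◅ ≡⇒⟶β* (cong (λ l' → trC (cmd t l') ρ G K) (sym (++ₗ-identityʳ l)))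
      trC-⟶C (π {t} {l} consE) ρ G K =
        trC-⟶⁺G (cmd t l) (sG⟶G G) ⁺◅◅ ≡⇒⟶β* (trC-++ₗ t l)
      trC-⟶C {n = n} (σ {t} {c}) ρ G K =
        [ β-≡ (sub1Λ-as-subΛ (trC c (ext ρ) (wkΛ G) (wkΛ K)) T) ]
        ⁺◅◅ subΛ-trC-subT (Simulates-single t ρ) c (wkΛ G) (wkΛ K)
        ◅◅ ≡⇒⟶β* (trans (cong₂ (trC (subC (singleT t) c) ρ)
                                (subΛ-single-wkΛ T G) (subΛ-single-wkΛ T K))
                        (cong (λ c' → trC c' ρ G K) (sym (sub1C-as-subC c t))))
        where
        T : Λ n
        T = barT t ρ
      trC-⟶C (ξcmdₗ {l = nil} t⟶t')      ρ G K = trT-⟶T t⟶t' ρ G K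
      trC-⟶C (ξcmdₗ {l = cons u l} t⟶t') ρ G K = trT-⟶T t⟶t' ρ G (pairK l u ρ G K)
      trC-⟶C (ξcmdₗ {l = mu c} t⟶t')     ρ G K =
        ⟶β⁺-map (app (trL (mu c) ρ G K)) ξappᵣ (barT-⟶T t⟶t' ρ)
      trC-⟶C (ξcmdᵣ {t} l⟶l')            ρ G K = trC-⟶L l⟶l' t ρ G K

theorem4p3 : (s : Λ 0) →
    (∀ {n : ℕ} (G : Λ n) → app (closedΛ s) G ⟶β⁺ G) →
    ∀ {n : ℕ} {t u : Term n} → t ⟶T u → CGPS.⟦_⟧ s t ⟶β⁺ CGPS.⟦_⟧ s u
theorem4p3 s sG⟶G t⟶u = barT-⟶T s sG⟶G t⟶u id
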